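{- Let $G$ be a simple undirected graph with $n$ vertices. Then the cycle matroid $M[G]$ is isomorphic to $M[\beta(G,n)]$ for every coding sequence $\beta(G,n)$ of $G$.
   Context: Coding sequences: for a simple graph $G=(V,E)$ with $n$ vertices, choose a labeling $V=\{v_0,\ldots,v_{n-1}\}$. For an edge $e=v_iv_j$ with $i>j$ let $f^\#(e)=(x_1,\ldots,x_{n-1})\in\mathbb{Z}_2^{n-1}$ with $x_k=1$ iff $n-i\le k\le n-j-1$ and $x_k=0$ otherwise. The coding sequence $\beta(G,n)$ for that labeling is $\{f^\#(e):e\in E\}$. For non-empty $S\subseteq\mathbb{Z}_2^{n-1}$, $M[S]$ is the column matroid over $\mathbb{Z}_2$ of the matrix whose columns are exactly the elements of $S$. $M[G]$ is the cycle matroid of $G$ (elements: edges; circuits: cycles). -}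

module Defs where

open import Data.Nat using (ℕ; _∸_; _≤ᵇ_; _≥_; suc)
open import Data.Nat.Base using (_⊔_; _⊓_)
open import Data.Bool using (Bool; true; false; _∧_; _xor_)
open import Data.Fin using (Fin; toℕ)
open import Data.Vec using (Vec; tabulate; zipWith; replicate)
open import Data.List using (List; []; _∷_; _++_; [_]; zip; length; map; foldr)
open import Data.List.Relation.Unary.All using (All)
open import Data.List.Relation.Unary.Unique.Propositional using (Unique)
open import Data.Product using (Σ; Σ-syntax; ∃; _×_; _,_; proj₁; proj₂)
open import Data.Sum using (_⊎_)
open import Relation.Binary.PropositionalEquality using (_≡_; _≢_)
open import Relation.Nullary using (¬_)
open import Function.Bundles using (_↔_; _⇔_; Inverse)

record SimpleGraph (V : Set) : Set₁ where
  field
    E    : Set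
    ends : E → V × V

  Joins : E → V → V → Set
  Joins e u w = (ends e ≡ (u , w)) ⊎ (ends e ≡ (w , u))

  field
    loopless : ∀ e → proj₁ (ends e) ≢ proj₂ (ends e)
    noMulti  : ∀ e e′ → Joins e (proj₁ (ends e′)) (proj₂ (ends e′)) → e ≡ e′

open SimpleGraph public

-- Only these data enter the
-- notion of isomorphism, so the matroid axioms are not recorded.

record Matroid : Set₁ where
  field
    Ground : Set
    Indep  : (Ground → Set) → Set

open Matroid public

_≅ᴹ_ : Matroid → Matroid → Set₁
M ≅ᴹ N = Σ[ φ ∈ Ground M ↔ Ground N ]
           (∀ (X : Ground M → Set) →
              Indep M X ⇔ Indep N (λ y → X (Inverse.from φ y)))

cyclicPairs : {A : Set} → List A → List (A × A)
cyclicPairs []       = []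
cyclicPairs (x ∷ xs) = zip (x ∷ xs) (xs ++ [ x ])

ContainsCycle : {V : Set} (G : SimpleGraph V) → (E G → Set) → Set
ContainsCycle {V} G X =
  Σ[ cs ∈ List V ] (length cs ≥ 3 × Unique cs ×
     All (λ p → Σ[ e ∈ E G ] (X e × Joins G e (proj₁ p) (proj₂ p)))
         (cyclicPairs cs))

CycleMatroid : {V : Set} → SimpleGraph V → Matroid
CycleMatroid G = record
  { Ground = E G
  ; Indep  = λ X → ¬ ContainsCycle G X }

-- Vectors of ℤ₂^{n-1}: Vec Bool (n ∸ 1), position p ↔ coordinate k = p+1.

Z2Vec : ℕ → Set
Z2Vec n = Vec Bool (n ∸ 1)

zeroV : (n : ℕ) → Z2Vec n
zeroV n = replicate _ false

_+V_ : {n : ℕ} → Z2Vec n → Z2Vec n → Z2Vec n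
_+V_ = zipWith _xor_

sumV : (n : ℕ) → List (Z2Vec n) → Z2Vec n
sumV n = foldr (_+V_ {n}) (zeroV n)

-- column matroid M[S] over ℤ₂ of the matrix whose columns are the elements
-- of S ⊆ ℤ₂^{n-1}: ground set S; X is independent iff no nontrivial
-- ℤ₂-linear combination of (distinct) elements of X vanishes, i.e. no
-- nonempty list of distinct elements of X sums to zero.
ColumnMatroid : (n : ℕ) → (Z2Vec n → Set) → Matroid
ColumnMatroid n S = record
  { Ground = Σ (Z2Vec n) S
  ; Indep  = λ X → ¬ (Σ[ L ∈ List (Σ (Z2Vec n) S) ]
                      (L ≢ [] × Unique (map proj₁ L) × All X L ×
                       sumV n (map proj₁ L) ≡ zeroV n)) }

-- Coding sequences.  A labeling is a bijection Fin n ↔ V, k ↦ v_k.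

codeVec : (n i j : ℕ) → Z2Vec n
codeVec n i j = tabulate λ p →
  let k = suc (toℕ p) in ((n ∸ i) ≤ᵇ k) ∧ (k ≤ᵇ (n ∸ j ∸ 1))

module _ {V : Set} (n : ℕ) (G : SimpleGraph V) (lab : Fin n ↔ V) where
  fSharp : E G → Z2Vec n
  fSharp e =
    let a = toℕ (Inverse.from lab (proj₁ (ends G e)))
        b = toℕ (Inverse.from lab (proj₂ (ends G e)))
    in codeVec n (a ⊔ b) (a ⊓ b)

  β : Z2Vec n → Set
  β x = ∃ λ e → fSharp e ≡ x

module Submission where

-- Write idx v < n for the label of a vertex v and say that an edge uv
-- crosses the cut s when exactly one of idx u, idx v is ≥ s.  Coordinate k
-- of f#(uv) records whether uv crosses the cut n - k (code-coordinate);
-- cuts 0 and ≥ n are crossed by no edge, so every cut is trivial or a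
-- coordinate.  A vertex w is an endpoint of e iff e crosses exactly one of
-- the cuts idx w, idx w + 1 (incident-cuts).  Hence
--  * equal codes give equal incidences, so f# is injective (G is simple)
--    and e ↦ f#(e) is a bijection E → β(G,n);
--  * edges with zero code sum meet every vertex an even number of times,
--    and in such an edge list walking along fresh edges closes a cycle
--    because paths have at most n vertices (EvenDegreeCycle);
--  * along a cycle the crossings telescope to zero, and the edges of a
--    cycle are distinct (CycleColumns).

open import Defs
open import Algebra.Bundles using (CommutativeRing)
open import Data.Bool using (Bool; true; false; not; _∧_; _xor_; T)
open import Data.Bool.Properties using (xor-comm; xor-assoc; xor-same; xor-identityʳ; xor-∧-commutativeRing; not-injective)
open import Data.Empty using (⊥-elim)
open import Data.Fin using (Fin; toℕ; fromℕ<)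
open import Data.Fin.Properties using (toℕ<n; toℕ-fromℕ<; toℕ-injective; injective⇒≤) renaming (_≟_ to _≟ᶠ_)
open import Data.List using (List; []; _∷_; _++_; [_]; map; zip; length)
import Data.List as List
open import Data.List.Properties using (map-∘)
open import Data.List.Membership.Propositional using (_∈_)
open import Data.List.Membership.Propositional.Properties using (∈-lookup)
open import Data.List.Relation.Unary.All using (All; []; _∷_)
import Data.List.Relation.Unary.All as All
import Data.List.Relation.Unary.All.Properties as All
open import Data.List.Relation.Unary.All.Properties.Core using (¬Any⇒All¬)
open import Data.List.Relation.Unary.AllPairs using (AllPairs; []; _∷_)
open import Data.List.Relation.Unary.Any using (here; there; any?)
open import Data.List.Relation.Unary.Linked using (Linked; [-]; _∷_)
open import Data.List.Relation.Unary.Unique.Propositional using (Unique)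
import Data.List.Relation.Unary.Unique.Propositional.Properties as Unique
open import Data.Nat using (ℕ; zero; suc; _+_; _∸_; _≤_; _<_; _≥_; _≤ᵇ_; _≡ᵇ_; _⊔_; _⊓_; z≤n; s≤s; _≤?_)
open import Data.Nat.Properties
open import Data.Product using (Σ; Σ-syntax; _×_; _,_; proj₁; proj₂)
open import Data.Sum using (_⊎_; inj₁; inj₂)
open import Data.Unit using (tt)
open import Data.Vec using (Vec; lookup; tabulate)
open import Data.Vec.Properties using (lookup∘tabulate; lookup-zipWith; lookup-replicate; tabulate∘lookup; tabulate-cong)
open import Function.Bundles using (_↔_; Inverse; mk↔ₛ′; mk⇔)
open import Relation.Binary using (DecidableEquality)
open import Relation.Binary.PropositionalEquality hiding ([_])
open import Relation.Nullary using (¬_; yes; no; contradiction)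
open import Relation.Nullary.Decidable using (map′)
open import Relation.Nullary.Reflects using (ofʸ; ofⁿ)
open import Algebra.Properties.CommutativeSemigroup (CommutativeRing.+-commutativeSemigroup xor-∧-commutativeRing) using (interchange)

open ≡-Reasoning

parity : {A : Set} → (A → Bool) → List A → Bool
parity f []       = false
parity f (x ∷ xs) = f x xor parity f xs

parity-cong : {A : Set} {f g : A → Bool} → (∀ x → f x ≡ g x) → ∀ xs → parity f xs ≡ parity g xs
parity-cong f≗g []       = refl
parity-cong f≗g (x ∷ xs) = cong₂ _xor_ (f≗g x) (parity-cong f≗g xs)

parity-zero : {A : Set} {f : A → Bool} → (∀ x → f x ≡ false) → ∀ xs → parity f xs ≡ false
parity-zero f≡0 []       = refl
parity-zero f≡0 (x ∷ xs) rewrite f≡0 x = parity-zero f≡0 xs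

parity-xor : {A : Set} (f g : A → Bool) → ∀ xs → parity (λ x → f x xor g x) xs ≡ parity f xs xor parity g xs
parity-xor f g []       = refl
parity-xor f g (x ∷ xs) = begin
  (f x xor g x) xor parity (λ y → f y xor g y) xs  ≡⟨ cong ((f x xor g x) xor_) (parity-xor f g xs) ⟩
  (f x xor g x) xor (parity f xs xor parity g xs)  ≡⟨ interchange (f x) (g x) (parity f xs) (parity g xs) ⟩
  (f x xor parity f xs) xor (g x xor parity g xs)  ∎

odd-witness : {A : Set} (f : A → Bool) (xs : List A) → parity f xs ≡ true → Σ[ x ∈ A ] (x ∈ xs × f x ≡ true)
odd-witness f (x ∷ xs) odd with f x in fx
... | true  = x , here refl , fx
... | false with odd-witness f xs odd
...   | y , y∈xs , fy = y , there y∈xs , fy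

even-partner : {A : Set} (f : A → Bool) {e : A} (xs : List A) → Unique xs → e ∈ xs →
  parity f xs ≡ false → f e ≡ true → Σ[ e′ ∈ A ] (e′ ∈ xs × e′ ≢ e × f e′ ≡ true)
even-partner f (x ∷ xs) (x∉xs ∷ _) (here refl) even fx rewrite fx with odd-witness f xs (not-injective even)
... | y , y∈xs , fy = y , there y∈xs , (λ y≡x → All.lookup x∉xs y∈xs (sym y≡x)) , fy
even-partner f (x ∷ xs) (x∉xs ∷ uxs) (there e∈xs) even fe with f x in fx
... | true  = x , here refl , All.lookup x∉xs e∈xs , fx
... | false with even-partner f xs uxs e∈xs even fe
...   | y , y∈xs , y≢e , fy = y , there y∈xs , y≢e , fy

xor-telescope : ∀ x y z → (x xor y) xor (y xor z) ≡ x xor z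
xor-telescope x y z = begin
  (x xor y) xor (y xor z)  ≡⟨ xor-assoc x y (y xor z) ⟩
  x xor (y xor (y xor z))  ≡⟨ cong (x xor_) (sym (xor-assoc y y z)) ⟩
  x xor ((y xor y) xor z)  ≡⟨ cong (λ b → x xor (b xor z)) (xor-same y) ⟩
  x xor z                  ∎

≤ᵇ-≡ : ∀ {m n m′ n′} → (m ≤ n → m′ ≤ n′) → (m′ ≤ n′ → m ≤ n) → (m ≤ᵇ n) ≡ (m′ ≤ᵇ n′)
≤ᵇ-≡ {m} {n} {m′} {n′} to from with m ≤ᵇ n | ≤ᵇ-reflects-≤ m n | m′ ≤ᵇ n′ | ≤ᵇ-reflects-≤ m′ n′
... | true  | _        | true  | _        = refl
... | false | _        | false | _        = refl
... | true  | ofʸ m≤n  | false | ofⁿ m′≰n′ = contradiction (to m≤n) m′≰n′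
... | false | ofⁿ m≰n  | true  | ofʸ m′≤n′ = contradiction (from m′≤n′) m≰n

≤ᵇ-false : ∀ {m n} → n < m → (m ≤ᵇ n) ≡ false
≤ᵇ-false {m} {n} n<m with m ≤ᵇ n | ≤ᵇ-reflects-≤ m n
... | false | _       = refl
... | true  | ofʸ m≤n = contradiction m≤n (<⇒≱ n<m)

≤ᵇ-complement : ∀ k x → (k ≤ᵇ x) ≡ not (suc x ≤ᵇ k)
≤ᵇ-complement k x with k ≤ᵇ x | ≤ᵇ-reflects-≤ k x | suc x ≤ᵇ k | ≤ᵇ-reflects-≤ (suc x) k
... | true  | _       | false | _       = refl
... | false | _       | true  | _       = refl
... | true  | ofʸ k≤x | true  | ofʸ x<k = contradiction k≤x (<⇒≱ x<k)
... | false | ofⁿ k≰x | false | ofⁿ x≮k = contradiction (≰⇒> k≰x) x≮k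

≤ᵇ-suc : ∀ m n → (suc m ≤ᵇ suc n) ≡ (m ≤ᵇ n)
≤ᵇ-suc zero    n = refl
≤ᵇ-suc (suc m) n = refl

cut-step : ∀ s a → (s ≤ᵇ a) xor (suc s ≤ᵇ a) ≡ (a ≡ᵇ s)
cut-step zero    zero    = refl
cut-step zero    (suc a) = refl
cut-step (suc s) zero    = refl
cut-step (suc s) (suc a) = trans (cong₂ _xor_ (≤ᵇ-suc s a) (≤ᵇ-suc (suc s) a)) (cut-step s a)

≡ᵇ-refl : ∀ m → (m ≡ᵇ m) ≡ true
≡ᵇ-refl zero    = refl
≡ᵇ-refl (suc m) = ≡ᵇ-refl m

≡ᵇ-sound : ∀ {m n} → (m ≡ᵇ n) ≡ true → m ≡ n
≡ᵇ-sound {m} {n} eq = ≡ᵇ⇒≡ m n (subst T (sym eq) tt)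

≡ᵇ-false : ∀ {m n} → m ≢ n → (m ≡ᵇ n) ≡ false
≡ᵇ-false {m} {n} m≢n with m ≡ᵇ n in eq
... | false = refl
... | true  = contradiction (≡ᵇ-sound eq) m≢n

-- for i, k ≤ n:  n - i ≤ k  ⇔  i + k ≥ n  ⇔  n - k ≤ i
complement-swap : ∀ {i n k} → i ≤ n → n ∸ i ≤ k → n ∸ k ≤ i
complement-swap {i} {n} {k} i≤n n∸i≤k =
  m≤n+o⇒m∸n≤o n k (subst (_≤ k + i) (m∸n+n≡m i≤n) (+-monoˡ-≤ i n∸i≤k))

cut-flip : ∀ {i n k} → i ≤ n → k ≤ n → (n ∸ i ≤ᵇ k) ≡ (n ∸ k ≤ᵇ i)
cut-flip i≤n k≤n = ≤ᵇ-≡ (complement-swap i≤n) (complement-swap k≤n)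

cut-upper : ∀ {j n k} → j < n → k ≤ n → (k ≤ᵇ n ∸ j ∸ 1) ≡ not (n ∸ k ≤ᵇ j)
cut-upper {j} {n} {k} j<n k≤n = begin
  k ≤ᵇ n ∸ j ∸ 1               ≡⟨ cong (k ≤ᵇ_) (trans (∸-+-assoc n j 1) (cong (n ∸_) (+-comm j 1))) ⟩
  k ≤ᵇ n ∸ suc j               ≡⟨ ≤ᵇ-complement k (n ∸ suc j) ⟩
  not (suc (n ∸ suc j) ≤ᵇ k)   ≡⟨ cong (λ x → not (x ≤ᵇ k)) (sym (+-∸-assoc 1 j<n)) ⟩
  not (n ∸ j ≤ᵇ k)             ≡⟨ cong not (cut-flip (<⇒≤ j<n) k≤n) ⟩
  not (n ∸ k ≤ᵇ j)             ∎

implies-xor : ∀ x y → (T x → T y) → y ∧ not x ≡ x xor y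
implies-xor true  true  _   = refl
implies-xor true  false x⇒y = ⊥-elim (x⇒y tt)
implies-xor false true  _   = refl
implies-xor false false _   = refl

codeVec-ordered : ∀ {n a b k} → a ≤ b → b < n → k ≤ n →
  (n ∸ b ≤ᵇ k) ∧ (k ≤ᵇ n ∸ a ∸ 1) ≡ (n ∸ k ≤ᵇ a) xor (n ∸ k ≤ᵇ b)
codeVec-ordered {n} {a} {b} {k} a≤b b<n k≤n = begin
  (n ∸ b ≤ᵇ k) ∧ (k ≤ᵇ n ∸ a ∸ 1)    ≡⟨ cong₂ _∧_ (cut-flip (<⇒≤ b<n) k≤n) (cut-upper (≤-<-trans a≤b b<n) k≤n) ⟩
  (n ∸ k ≤ᵇ b) ∧ not (n ∸ k ≤ᵇ a)    ≡⟨ implies-xor (n ∸ k ≤ᵇ a) (n ∸ k ≤ᵇ b) below-a⇒below-b ⟩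
  (n ∸ k ≤ᵇ a) xor (n ∸ k ≤ᵇ b)      ∎
  where
  below-a⇒below-b : T (n ∸ k ≤ᵇ a) → T (n ∸ k ≤ᵇ b)
  below-a⇒below-b t = ≤⇒≤ᵇ (≤-trans (≤ᵇ⇒≤ (n ∸ k) a t) a≤b)

codeVec-coordinate : ∀ {n a b k} → a < n → b < n → k ≤ n →
  (n ∸ (a ⊔ b) ≤ᵇ k) ∧ (k ≤ᵇ n ∸ (a ⊓ b) ∸ 1) ≡ (n ∸ k ≤ᵇ a) xor (n ∸ k ≤ᵇ b)
codeVec-coordinate {n} {a} {b} {k} a<n b<n k≤n with ≤-total a b
... | inj₁ a≤b rewrite m≤n⇒m⊔n≡n a≤b | m≤n⇒m⊓n≡m a≤b = codeVec-ordered a≤b b<n k≤n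
... | inj₂ b≤a rewrite m≥n⇒m⊔n≡m b≤a | m≥n⇒m⊓n≡n b≤a =
  trans (codeVec-ordered b≤a a<n k≤n) (xor-comm (n ∸ k ≤ᵇ b) (n ∸ k ≤ᵇ a))

lookup-sumV : {A : Set} (n : ℕ) (f : A → Z2Vec n) (xs : List A) (p : Fin (n ∸ 1)) →
  lookup (sumV n (map f xs)) p ≡ parity (λ x → lookup (f x) p) xs
lookup-sumV n f []       p = lookup-replicate p false
lookup-sumV n f (x ∷ xs) p =
  trans (lookup-zipWith _xor_ p (f x) (sumV n (map f xs))) (cong (lookup (f x) p xor_) (lookup-sumV n f xs p))

vec-ext : ∀ {m} {A : Set} (xs ys : Vec A m) → (∀ i → lookup xs i ≡ lookup ys i) → xs ≡ ys
vec-ext xs ys pointwise = begin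
  xs                  ≡⟨ sym (tabulate∘lookup xs) ⟩
  tabulate (lookup xs) ≡⟨ tabulate-cong pointwise ⟩
  tabulate (lookup ys) ≡⟨ tabulate∘lookup ys ⟩
  ys                  ∎

SamePair : {V : Set} → V × V → V × V → Set
SamePair p q = (p ≡ q) ⊎ (p ≡ (proj₂ q , proj₁ q))

module SimpleGraphFacts {V : Set} (G : SimpleGraph V) where

  src tgt : E G → V
  src e = proj₁ (ends G e)
  tgt e = proj₂ (ends G e)

  Spans : (E G → Set) → V × V → Set
  Spans X p = Σ[ e ∈ E G ] (X e × Joins G e (proj₁ p) (proj₂ p))

  joins-irrefl : ∀ {e x y} → Joins G e x y → x ≢ y
  joins-irrefl {e} (inj₁ eq) x≡y = loopless G e (trans (cong proj₁ eq) (trans x≡y (sym (cong proj₂ eq))))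
  joins-irrefl {e} (inj₂ eq) x≡y = loopless G e (trans (cong proj₁ eq) (trans (sym x≡y) (sym (cong proj₂ eq))))

  joins-sym : ∀ {e x y} → Joins G e x y → Joins G e y x
  joins-sym (inj₁ eq) = inj₂ eq
  joins-sym (inj₂ eq) = inj₁ eq

  joins-pair : ∀ {e x y x′ y′} → Joins G e x y → Joins G e x′ y′ → SamePair (x , y) (x′ , y′)
  joins-pair (inj₁ eq) (inj₁ eq′) = inj₁ (trans (sym eq) eq′)
  joins-pair (inj₁ eq) (inj₂ eq′) = inj₂ (trans (sym eq) eq′)
  joins-pair (inj₂ eq) (inj₁ eq′) = inj₂ (cong (λ q → proj₂ q , proj₁ q) (trans (sym eq) eq′))
  joins-pair (inj₂ eq) (inj₂ eq′) = inj₁ (cong (λ q → proj₂ q , proj₁ q) (trans (sym eq) eq′))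

  same-endpoints⇒same-edge : ∀ {e e′} → (src e ≡ src e′) ⊎ (tgt e ≡ src e′) → (src e ≡ tgt e′) ⊎ (tgt e ≡ tgt e′) → e ≡ e′
  same-endpoints⇒same-edge {e} {e′} (inj₁ s≡s′) (inj₁ s≡t′) = contradiction (trans (sym s≡s′) s≡t′) (loopless G e′)
  same-endpoints⇒same-edge {e} {e′} (inj₂ t≡s′) (inj₂ t≡t′) = contradiction (trans (sym t≡s′) t≡t′) (loopless G e′)
  same-endpoints⇒same-edge {e} {e′} (inj₁ s≡s′) (inj₂ t≡t′) = noMulti G e e′ (inj₁ (cong₂ _,_ s≡s′ t≡t′))
  same-endpoints⇒same-edge {e} {e′} (inj₂ t≡s′) (inj₁ s≡t′) = noMulti G e e′ (inj₂ (cong₂ _,_ s≡t′ t≡s′))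

  joins-unique : ∀ {e e′ x y} → Joins G e x y → Joins G e′ x y → e′ ≡ e
  joins-unique (inj₁ eq) j′ = noMulti G _ _ (subst (λ q → Joins G _ (proj₁ q) (proj₂ q)) (sym eq) j′)
  joins-unique (inj₂ eq) j′ = noMulti G _ _ (subst (λ q → Joins G _ (proj₁ q) (proj₂ q)) (sym eq) (joins-sym j′))

lookup-injective : {A : Set} (xs : List A) → Unique xs → ∀ i j → List.lookup xs i ≡ List.lookup xs j → i ≡ j
lookup-injective (x ∷ xs) (x∉xs ∷ uxs) Fin.zero    Fin.zero    eq = refl
lookup-injective (x ∷ xs) (x∉xs ∷ uxs) Fin.zero    (Fin.suc j) eq = contradiction eq (All.lookup x∉xs (∈-lookup j))
lookup-injective (x ∷ xs) (x∉xs ∷ uxs) (Fin.suc i) Fin.zero    eq = contradiction (sym eq) (All.lookup x∉xs (∈-lookup i))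
lookup-injective (x ∷ xs) (x∉xs ∷ uxs) (Fin.suc i) (Fin.suc j) eq = cong Fin.suc (lookup-injective xs uxs i j eq)

-- Labelled graphs: cuts, incidences and codes

module Labelled {V : Set} (n : ℕ) (G : SimpleGraph V) (lab : Fin n ↔ V) where
  open SimpleGraphFacts G
  open Inverse lab using (to; from; strictlyInverseˡ)

  from-injective : ∀ {u v} → from u ≡ from v → u ≡ v
  from-injective {u} {v} eq = trans (sym (strictlyInverseˡ u)) (trans (cong to eq) (strictlyInverseˡ v))

  _≟V_ : DecidableEquality V
  u ≟V v = map′ from-injective (cong from) (from u ≟ᶠ from v)

  distinct-bound : (vs : List V) → Unique vs → length vs ≤ n
  distinct-bound vs uvs = injective⇒≤ (λ eq → lookup-injective vs uvs _ _ (from-injective eq))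

  idx : V → ℕ
  idx v = toℕ (from v)

  idx<n : ∀ v → idx v < n
  idx<n v = toℕ<n (from v)

  idx-injective : ∀ {u v} → idx u ≡ idx v → u ≡ v
  idx-injective eq = from-injective (toℕ-injective eq)

  above : ℕ → V → Bool
  above s v = s ≤ᵇ idx v

  crosses : ℕ → E G → Bool
  crosses s e = above s (src e) xor above s (tgt e)

  incident : V → E G → Bool
  incident w e = (idx (src e) ≡ᵇ idx w) xor (idx (tgt e) ≡ᵇ idx w)

  code : E G → Z2Vec n
  code = fSharp n G lab

  code-coordinate : ∀ e p → lookup (code e) p ≡ crosses (n ∸ suc (toℕ p)) e
  code-coordinate e p = trans (lookup∘tabulate _ p)
    (codeVec-coordinate (idx<n (src e)) (idx<n (tgt e)) (≤-trans (toℕ<n p) (m∸n≤m n 1)))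

  incident-cuts : ∀ w e → incident w e ≡ crosses (idx w) e xor crosses (suc (idx w)) e
  incident-cuts w e = sym (begin
    crosses m e xor crosses (suc m) e                       ≡⟨ interchange (above m (src e)) (above m (tgt e)) _ _ ⟩
    (above m (src e) xor above (suc m) (src e)) xor
      (above m (tgt e) xor above (suc m) (tgt e))           ≡⟨ cong₂ _xor_ (cut-step m (idx (src e))) (cut-step m (idx (tgt e))) ⟩
    incident w e                                            ∎)
    where m = idx w

  crosses-joins : ∀ {e u v} s → Joins G e u v → crosses s e ≡ above s u xor above s v
  crosses-joins s (inj₁ eq) rewrite eq = refl
  crosses-joins {u = u} {v} s (inj₂ eq) rewrite eq = xor-comm (above s v) (above s u)

  cut-is-coordinate : ∀ s → (∀ e → crosses s e ≡ false) ⊎ Σ[ p ∈ Fin (n ∸ 1) ] (∀ e → crosses s e ≡ lookup (code e) p)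
  cut-is-coordinate zero = inj₁ (λ e → refl)
  cut-is-coordinate (suc s) with n ≤? suc s
  ... | yes n≤s+1 = inj₁ (λ e → cong₂ _xor_ (below (src e)) (below (tgt e)))
    where
    below : ∀ v → above (suc s) v ≡ false
    below v = ≤ᵇ-false (<-≤-trans (idx<n v) n≤s+1)
  ... | no n≰s+1 = inj₂ (p , λ e → sym (trans (code-coordinate e p) (cong (λ t → crosses t e) cut≡s+1)))
    where
    s+1<n : suc s < n
    s+1<n = ≰⇒> n≰s+1
    p<n-1 : n ∸ suc (suc s) < n ∸ 1
    p<n-1 = ∸-monoʳ-< {n} {suc (suc s)} {1} (s≤s (s≤s z≤n)) s+1<n
    p : Fin (n ∸ 1)
    p = fromℕ< p<n-1
    cut≡s+1 : n ∸ suc (toℕ p) ≡ suc s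
    cut≡s+1 = begin
      n ∸ suc (toℕ p)             ≡⟨ cong (λ x → n ∸ suc x) (toℕ-fromℕ< p<n-1) ⟩
      n ∸ suc (n ∸ suc (suc s))   ≡⟨ cong (n ∸_) (sym (+-∸-assoc 1 s+1<n)) ⟩
      n ∸ (n ∸ suc s)             ≡⟨ m∸[m∸n]≡n (<⇒≤ s+1<n) ⟩
      suc s                       ∎

  zero-sum⇒even-cuts : ∀ es → sumV n (map code es) ≡ zeroV n → ∀ s → parity (crosses s) es ≡ false
  zero-sum⇒even-cuts es sum≡0 s with cut-is-coordinate s
  ... | inj₁ never = parity-zero never es
  ... | inj₂ (p , coordinate) = begin
    parity (crosses s) es                 ≡⟨ parity-cong coordinate es ⟩
    parity (λ e → lookup (code e) p) es   ≡⟨ sym (lookup-sumV n code es p) ⟩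
    lookup (sumV n (map code es)) p       ≡⟨ cong (λ v → lookup v p) sum≡0 ⟩
    lookup (zeroV n) p                    ≡⟨ lookup-replicate p false ⟩
    false                                 ∎

  zero-sum⇒even-degrees : ∀ es → sumV n (map code es) ≡ zeroV n → ∀ w → parity (incident w) es ≡ false
  zero-sum⇒even-degrees es sum≡0 w = begin
    parity (incident w) es                                       ≡⟨ parity-cong (incident-cuts w) es ⟩
    parity (λ e → crosses (idx w) e xor crosses (suc (idx w)) e) es ≡⟨ parity-xor (crosses (idx w)) (crosses (suc (idx w))) es ⟩
    parity (crosses (idx w)) es xor parity (crosses (suc (idx w))) es
      ≡⟨ cong₂ _xor_ (zero-sum⇒even-cuts es sum≡0 (idx w)) (zero-sum⇒even-cuts es sum≡0 (suc (idx w))) ⟩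
    false                                                        ∎

  same-code⇒same-cuts : ∀ {e e′} → code e ≡ code e′ → ∀ s → crosses s e ≡ crosses s e′
  same-code⇒same-cuts {e} {e′} same s with cut-is-coordinate s
  ... | inj₁ never = trans (never e) (sym (never e′))
  ... | inj₂ (p , coordinate) = trans (coordinate e) (trans (cong (λ v → lookup v p) same) (sym (coordinate e′)))

  same-code⇒same-incidence : ∀ {e e′} → code e ≡ code e′ → ∀ w → incident w e ≡ incident w e′
  same-code⇒same-incidence same w = begin
    incident w _                                       ≡⟨ incident-cuts w _ ⟩
    crosses (idx w) _ xor crosses (suc (idx w)) _      ≡⟨ cong₂ _xor_ (same-code⇒same-cuts same (idx w)) (same-code⇒same-cuts same (suc (idx w))) ⟩
    crosses (idx w) _ xor crosses (suc (idx w)) _      ≡⟨ sym (incident-cuts w _) ⟩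
    incident w _                                       ∎

  incident⇒endpoint : ∀ w e → incident w e ≡ true → (src e ≡ w) ⊎ (tgt e ≡ w)
  incident⇒endpoint w e inc with idx (src e) ≡ᵇ idx w in eq
  ... | true  = inj₁ (idx-injective (≡ᵇ-sound eq))
  ... | false = inj₂ (idx-injective (≡ᵇ-sound inc))

  incident⇒joins : ∀ w e → incident w e ≡ true → Σ[ u ∈ V ] Joins G e w u
  incident⇒joins w e inc with incident⇒endpoint w e inc
  ... | inj₁ refl = tgt e , inj₁ refl
  ... | inj₂ refl = src e , inj₂ refl

  joins⇒incident : ∀ {e w u} → Joins G e w u → incident w e ≡ true
  joins⇒incident {e} {w} {u} j@(inj₁ eq) rewrite eq =
    cong₂ _xor_ (≡ᵇ-refl (idx w)) (≡ᵇ-false (λ eq′ → joins-irrefl j (sym (idx-injective eq′))))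
  joins⇒incident {e} {w} {u} j@(inj₂ eq) rewrite eq =
    cong₂ _xor_ (≡ᵇ-false (λ eq′ → joins-irrefl j (sym (idx-injective eq′)))) (≡ᵇ-refl (idx w))

  -- f# is injective: both endpoints of e′ are incident to e when the codes agree
  code-injective : ∀ {e e′} → code e ≡ code e′ → e ≡ e′
  code-injective {e} {e′} same = same-endpoints⇒same-edge
    (incident⇒endpoint (src e′) e (trans (same-code⇒same-incidence same (src e′)) (joins⇒incident {e′} (inj₁ refl))))
    (incident⇒endpoint (tgt e′) e (trans (same-code⇒same-incidence same (tgt e′)) (joins⇒incident {e′} (inj₂ refl))))

prefixTo : {A : Set} {u : A} (xs : List A) → u ∈ xs → List A
prefixTo (x ∷ xs) (here _)    = x ∷ []
prefixTo (x ∷ xs) (there u∈xs) = x ∷ prefixTo xs u∈xs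

prefixTo-All : {A : Set} {P : A → Set} {u : A} {xs : List A} (u∈xs : u ∈ xs) → All P xs → All P (prefixTo xs u∈xs)
prefixTo-All (here _)     (px ∷ _)   = px ∷ []
prefixTo-All (there u∈xs) (px ∷ pxs) = px ∷ prefixTo-All u∈xs pxs

prefixTo-Unique : {A : Set} {u : A} {xs : List A} (u∈xs : u ∈ xs) → Unique xs → Unique (prefixTo xs u∈xs)
prefixTo-Unique (here _)     (_ ∷ _)      = [] ∷ []
prefixTo-Unique (there u∈xs) (x∉xs ∷ uxs) = prefixTo-All u∈xs x∉xs ∷ prefixTo-Unique u∈xs uxs

prefixTo-nonempty : {A : Set} {u : A} {xs : List A} (u∈xs : u ∈ xs) → 1 ≤ length (prefixTo xs u∈xs)
prefixTo-nonempty (here _)  = s≤s z≤n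
prefixTo-nonempty (there _) = s≤s z≤n

close-path : {A : Set} {R : A → A → Set} {u c : A} (x : A) (xs : List A) (u∈xs : u ∈ xs) →
  Linked R (x ∷ xs) → R u c →
  All (λ p → R (proj₁ p) (proj₂ p)) (zip (x ∷ prefixTo xs u∈xs) (prefixTo xs u∈xs ++ [ c ]))
close-path x (y ∷ ys) (here refl)  (rxy ∷ _)    ruc = rxy ∷ ruc ∷ []
close-path x (y ∷ ys) (there u∈ys) (rxy ∷ rest) ruc = rxy ∷ close-path y ys u∈ys rest ruc

ContainsCycle-mono : {V : Set} (G : SimpleGraph V) {X Y : E G → Set} →
  (∀ {e} → X e → Y e) → ContainsCycle G X → ContainsCycle G Y
ContainsCycle-mono G X⊆Y (cs , len , ucs , edges) =
  cs , len , ucs , All.map (λ { (e , x , j) → e , X⊆Y x , j }) edges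

-- Edge lists with all degrees even contain a cycle

module EvenDegreeCycle {V : Set} (n : ℕ) (G : SimpleGraph V) (lab : Fin n ↔ V)
  (es : List (E G)) (ues : Unique es) (even : ∀ w → parity (Labelled.incident n G lab w) es ≡ false) where
  open SimpleGraphFacts G
  open Labelled n G lab

  Adjacent : V → V → Set
  Adjacent u v = Spans (_∈ es) (u , v)

  -- Extend a path w, prev, rest… of distinct, consecutively adjacent
  -- vertices (w is the current end) until it closes.  The edge e into w
  -- is matched, by evenness of the degree of w, by another edge e′ from w
  -- to some x: x = w is a loop, x = prev a second edge w–prev, x further
  -- along the path closes a cycle, and otherwise x extends the path.
  -- Paths have at most n vertices, so fuel bounds the remaining steps.
  extend : (fuel : ℕ) (w prev : V) (rest : List V) → suc n ≤ length (w ∷ prev ∷ rest) + fuel →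
    Unique (w ∷ prev ∷ rest) → Linked Adjacent (w ∷ prev ∷ rest) → ContainsCycle G (_∈ es)
  extend zero w prev rest room upath _ =
    contradiction (distinct-bound _ upath) (<⇒≱ (≤-trans room (≤-reflexive (+-identityʳ _))))
  extend (suc fuel) w prev rest room upath@((w∉ ∷ w∉rest) ∷ (prev∉rest ∷ urest)) path@(step@(e , e∈es , j) ∷ path′)
    with even-partner (incident w) es ues e∈es (even w) (joins⇒incident j)
  ... | e′ , e′∈es , e′≢e , incident-e′ with incident⇒joins w e′ incident-e′
  ... | x , j′ with any? (x ≟V_) (w ∷ prev ∷ rest)
  ... | yes (here x≡w)                = contradiction (sym x≡w) (joins-irrefl j′)
  ... | yes (there (here x≡prev))     = contradiction (joins-unique j (subst (Joins G e′ w) x≡prev j′)) e′≢e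
  ... | yes (there (there x∈rest))    =
    w ∷ prev ∷ prefixTo rest x∈rest ,
    s≤s (s≤s (prefixTo-nonempty x∈rest)) ,
    (w∉ ∷ prefixTo-All x∈rest w∉rest) ∷ (prefixTo-All x∈rest prev∉rest ∷ prefixTo-Unique x∈rest urest) ,
    step ∷ close-path prev rest x∈rest path′ (e′ , e′∈es , joins-sym j′)
  ... | no x∉path = extend fuel x w (prev ∷ rest) (subst (suc n ≤_) (+-suc _ fuel) room)
    (¬Any⇒All¬ _ x∉path ∷ upath) ((e′ , e′∈es , joins-sym j′) ∷ path)

  cycle-through : (e₀ : E G) → e₀ ∈ es → ContainsCycle G (_∈ es)
  cycle-through e₀ e₀∈es = extend n (tgt e₀) (src e₀) [] (n≤1+n (suc n))
    ((joins-irrefl j₀ ∷ []) ∷ ([] ∷ [])) ((e₀ , e₀∈es , j₀) ∷ [-])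
    where
    j₀ : Joins G e₀ (tgt e₀) (src e₀)
    j₀ = inj₂ refl

-- Cycles: distinct edges whose codes sum to zero

pathPairs : {V : Set} → V → List V → V → List (V × V)
pathPairs y ys c = zip (y ∷ ys) (ys ++ [ c ])

Avoids : {V : Set} → V → V × V → Set
Avoids x q = x ≢ proj₁ q × x ≢ proj₂ q

avoided-first : {V : Set} {x y : V} {q : V × V} → Avoids x q → ¬ SamePair (x , y) q
avoided-first (x≢q₁ , x≢q₂) (inj₁ eq) = x≢q₁ (cong proj₁ eq)
avoided-first (x≢q₁ , x≢q₂) (inj₂ eq) = x≢q₂ (cong proj₁ eq)

avoided-second : {V : Set} {x y : V} {q : V × V} → Avoids x q → ¬ SamePair (y , x) q
avoided-second (x≢q₁ , x≢q₂) (inj₁ eq) = x≢q₂ (cong proj₂ eq)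
avoided-second (x≢q₁ , x≢q₂) (inj₂ eq) = x≢q₁ (cong proj₂ eq)

pathPairs-avoid : {V : Set} {x : V} (y : V) (ys : List V) (c : V) → All (x ≢_) (y ∷ ys ++ [ c ]) →
  All (Avoids x) (pathPairs y ys c)
pathPairs-avoid y []       c (x≢y ∷ x≢c ∷ [])     = (x≢y , x≢c) ∷ []
pathPairs-avoid y (z ∷ zs) c (x≢y ∷ x≢z ∷ x∉rest) = (x≢y , x≢z) ∷ pathPairs-avoid z zs c (x≢z ∷ x∉rest)

pathPairs-distinct : {V : Set} (y : V) (ys : List V) (c : V) → Unique (y ∷ ys ++ [ c ]) →
  AllPairs (λ p q → ¬ SamePair p q) (pathPairs y ys c)
pathPairs-distinct y []       c _              = [] ∷ []
pathPairs-distinct y (z ∷ zs) c (y∉ ∷ upath) =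
  All.map avoided-first (pathPairs-avoid z zs c y∉) ∷ pathPairs-distinct z zs c upath

cyclicPairs-distinct : {V : Set} (cs : List V) → length cs ≥ 3 → Unique cs →
  AllPairs (λ p q → ¬ SamePair p q) (cyclicPairs cs)
cyclicPairs-distinct []          ()                _
cyclicPairs-distinct (_ ∷ [])     (s≤s ())          _
cyclicPairs-distinct (_ ∷ _ ∷ []) (s≤s (s≤s ()))    _
cyclicPairs-distinct (c₀ ∷ c₁ ∷ r₀ ∷ rs) _ ((c₀≢c₁ ∷ c₀∉rest) ∷ ((c₁≢r₀ ∷ c₁∉rs) ∷ urest)) =
  (first-pairs-differ ∷ All.map avoided-second (pathPairs-avoid r₀ rs c₀ c₁∉path))
  ∷ pathPairs-distinct c₁ (r₀ ∷ rs) c₀ rotated-unique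
  where
  first-pairs-differ : ¬ SamePair (c₀ , c₁) (c₁ , r₀)
  first-pairs-differ (inj₁ eq) = c₀≢c₁ (cong proj₁ eq)
  first-pairs-differ (inj₂ eq) = All.lookup c₀∉rest (here refl) (cong proj₁ eq)
  c₁∉path : All (c₁ ≢_) (r₀ ∷ rs ++ [ c₀ ])
  c₁∉path = c₁≢r₀ ∷ All.++⁺ c₁∉rs ((λ eq → c₀≢c₁ (sym eq)) ∷ [])
  rotated-unique : Unique (c₁ ∷ r₀ ∷ rs ++ [ c₀ ])
  rotated-unique = Unique.++⁺ ((c₁≢r₀ ∷ c₁∉rs) ∷ urest) ([] ∷ [])
    (λ { (v∈rest , here refl) → All.lookup (c₀≢c₁ ∷ c₀∉rest) v∈rest refl })

module CycleColumns {V : Set} (n : ℕ) (G : SimpleGraph V) (lab : Fin n ↔ V) where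
  open SimpleGraphFacts G
  open Labelled n G lab

  chosenEdges : {X : E G → Set} (ps : List (V × V)) → All (Spans X) ps → List (E G)
  chosenEdges []       []                = []
  chosenEdges (_ ∷ ps) ((e , _ , _) ∷ a) = e ∷ chosenEdges ps a

  chosenEdges-in : {X : E G → Set} (ps : List (V × V)) (a : All (Spans X) ps) → All X (chosenEdges ps a)
  chosenEdges-in []       []                = []
  chosenEdges-in (_ ∷ ps) ((_ , x , _) ∷ a) = x ∷ chosenEdges-in ps a

  chosenEdges-avoid : {X : E G → Set} {p : V × V} {e : E G} (ps : List (V × V)) →
    Joins G e (proj₁ p) (proj₂ p) → All (λ q → ¬ SamePair p q) ps → (a : All (Spans X) ps) → All (e ≢_) (chosenEdges ps a)
  chosenEdges-avoid []       _ []           []                 = []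
  chosenEdges-avoid (_ ∷ ps) j (p≉q ∷ p≉ps) ((_ , _ , j′) ∷ a) =
    (λ { refl → p≉q (joins-pair j j′) }) ∷ chosenEdges-avoid ps j p≉ps a

  chosenEdges-unique : {X : E G → Set} (ps : List (V × V)) → AllPairs (λ p q → ¬ SamePair p q) ps →
    (a : All (Spans X) ps) → Unique (chosenEdges ps a)
  chosenEdges-unique []       []           []                = []
  chosenEdges-unique (_ ∷ ps) (p≉ps ∷ dps) ((_ , _ , j) ∷ a) =
    chosenEdges-avoid ps j p≉ps a ∷ chosenEdges-unique ps dps a

  -- along a path the cut crossings telescope to those of its ends
  path-crossings : {X : E G → Set} (s : ℕ) (y : V) (ys : List V) (c : V) (a : All (Spans X) (pathPairs y ys c)) →
    parity (crosses s) (chosenEdges _ a) ≡ above s y xor above s c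
  path-crossings s y []       c ((_ , _ , j) ∷ []) = trans (xor-identityʳ _) (crosses-joins s j)
  path-crossings s y (z ∷ zs) c ((_ , _ , j) ∷ a) =
    trans (cong₂ _xor_ (crosses-joins s j) (path-crossings s z zs c a)) (xor-telescope (above s y) (above s z) (above s c))

  cycle-sum : {X : E G → Set} (c₀ : V) (cs : List V) (a : All (Spans X) (cyclicPairs (c₀ ∷ cs))) →
    sumV n (map code (chosenEdges _ a)) ≡ zeroV n
  cycle-sum c₀ cs a = vec-ext _ _ λ p → begin
    lookup (sumV n (map code (chosenEdges _ a))) p        ≡⟨ lookup-sumV n code (chosenEdges _ a) p ⟩
    parity (λ e → lookup (code e) p) (chosenEdges _ a)    ≡⟨ parity-cong (λ e → code-coordinate e p) (chosenEdges _ a) ⟩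
    parity (crosses (n ∸ suc (toℕ p))) (chosenEdges _ a)  ≡⟨ path-crossings (n ∸ suc (toℕ p)) c₀ cs c₀ a ⟩
    above (n ∸ suc (toℕ p)) c₀ xor above (n ∸ suc (toℕ p)) c₀ ≡⟨ xor-same (above (n ∸ suc (toℕ p)) c₀) ⟩
    false                                                 ≡⟨ sym (lookup-replicate p false) ⟩
    lookup (zeroV n) p                                    ∎

module Isomorphism {V : Set} (n : ℕ) (G : SimpleGraph V) (lab : Fin n ↔ V) where
  open Labelled n G lab
  open CycleColumns n G lab

  Column : Set
  Column = Σ (Z2Vec n) (β n G lab)

  column : E G → Column
  column e = code e , e , refl

  edge : Column → E G
  edge (_ , e , _) = e

  columns : E G ↔ Column
  columns = mk↔ₛ′ column edge (λ { (_ , e , refl) → refl }) (λ e → refl)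

  DependentIn : (Column → Set) → Set
  DependentIn Y = Σ[ L ∈ List Column ] (L ≢ [] × Unique (map proj₁ L) × All Y L × sumV n (map proj₁ L) ≡ zeroV n)

  codes-of-columns : (L : List Column) → map proj₁ L ≡ map code (map edge L)
  codes-of-columns []                 = refl
  codes-of-columns ((_ , _ , eq) ∷ L) = cong₂ _∷_ (sym eq) (codes-of-columns L)

  cycle⇒dependent : (X : E G → Set) → ContainsCycle G X → DependentIn (λ y → X (edge y))
  cycle⇒dependent X ([]          , ()             , _)
  cycle⇒dependent X (_ ∷ []     , s≤s ()         , _)
  cycle⇒dependent X (_ ∷ _ ∷ [] , s≤s (s≤s ())   , _)
  cycle⇒dependent X (c₀ ∷ c₁ ∷ c₂ ∷ cs , len , ucs , a@(_ ∷ _)) =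
    map column es , (λ ()) ,
    subst Unique (map-∘ es) (Unique.map⁺ code-injective (chosenEdges-unique _ (cyclicPairs-distinct _ len ucs) a)) ,
    All.map⁺ (chosenEdges-in _ a) ,
    subst (λ vs → sumV n vs ≡ zeroV n) (map-∘ es) (cycle-sum c₀ (c₁ ∷ c₂ ∷ cs) a)
    where
    es : List (E G)
    es = chosenEdges _ a

  dependent⇒cycle : (X : E G → Set) → DependentIn (λ y → X (edge y)) → ContainsCycle G X
  dependent⇒cycle X ([] , L≢[] , _) = contradiction refl L≢[]
  dependent⇒cycle X (L@(y ∷ _) , _ , ucodes , allX , sum≡0) =
    ContainsCycle-mono G (All.lookup (All.map⁺ allX))
      (EvenDegreeCycle.cycle-through n G lab es unique-edges (zero-sum⇒even-degrees es zero-sum) (edge y) (here refl))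
    where
    es : List (E G)
    es = map edge L
    unique-edges : Unique es
    unique-edges = Unique.map⁻ (subst Unique (codes-of-columns L) ucodes)
    zero-sum : sumV n (map code es) ≡ zeroV n
    zero-sum = subst (λ vs → sumV n vs ≡ zeroV n) (codes-of-columns L) sum≡0

lemma2 : {V : Set} (n : ℕ) (G : SimpleGraph V) (lab : Fin n ↔ V) →
    CycleMatroid G ≅ᴹ ColumnMatroid n (β n G lab)
lemma2 n G lab = columns , λ X →
  mk⇔ (λ acyclic dependent → acyclic (dependent⇒cycle X dependent))
      (λ independent cycle → independent (cycle⇒dependent X cycle))
  where open Isomorphism n G lab
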